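{- For every graph $G$, $\tfrac{1}{2}(\operatorname{bw}(G)+1)\leq\operatorname{ppw}(G)\leq\operatorname{bw}(G)$.
   Context: The width of a vertex ordering $(v_1,\dots,v_n)$ of $G$ is $\max\{|i-j| : v_iv_j\in E(G)\}$; the bandwidth $\operatorname{bw}(G)$ is the minimum width of a vertex ordering of $G$. For a graph $H$, an $H$-partition of $G$ is a function $f:V(G)\to V(H)$ such that for every edge $vw\in E(G)$, either $f(v)=f(w)$ or $f(v)f(w)\in E(H)$; its width is $\max_{x\in V(H)}|f^{ -1}(x)|$. The path-partition-width $\operatorname{ppw}(G)$ is the minimum integer $k$ such that $G$ has a $P$-partition of width $k$ for some path $P$. -}

module Defs where

open import Data.Nat using (ℕ; _⊔_; ∣_-_∣; _≤_)
open import Data.Fin using (Fin; toℕ)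
open import Data.Fin.Permutation using (Permutation′; _⟨$⟩ʳ_)
open import Data.Bool using (Bool; true; false; if_then_else_)
open import Data.List using (List; foldr; map; concatMap; length; filter)
open import Data.List.Base using (allFin)
open import Data.Product using (Σ; _×_)
open import Data.Sum using (_⊎_)
open import Relation.Binary.PropositionalEquality using (_≡_)
open import Data.Fin using (_≟_)

record Graph : Set where
  field
    n     : ℕ
    adj   : Fin n → Fin n → Bool
    sym   : ∀ v w → adj v w ≡ adj w v
    irrefl : ∀ v → adj v v ≡ false
open Graph public

Edge : (G : Graph) → Fin (n G) → Fin (n G) → Set
Edge G v w = adj G v w ≡ true

HasEdge : Graph → Set
HasEdge G = Σ (Fin (n G)) λ v → Σ (Fin (n G)) λ w → Edge G v w

maxL : List ℕ → ℕ
maxL = foldr _⊔_ 0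

-- A vertex ordering (v_1,…,v_n) is given by a bijection σ : V(G) → Fin n
-- assigning to each vertex its position.  Its width is
-- max { |i - j| : v_i v_j ∈ E(G) }.
orderingWidth : (G : Graph) → Permutation′ (n G) → ℕ
orderingWidth G σ =
  maxL (concatMap (λ v → map (λ w →
          if adj G v w
            then ∣ toℕ (σ ⟨$⟩ʳ v) - toℕ (σ ⟨$⟩ʳ w) ∣
            else 0) (allFin (n G))) (allFin (n G)))

IsBandwidth : Graph → ℕ → Set
IsBandwidth G b =
  Σ (Permutation′ (n G)) (λ σ → orderingWidth G σ ≡ b)
  × (∀ (σ : Permutation′ (n G)) → b ≤ orderingWidth G σ)

PathEdge : (m : ℕ) → Fin m → Fin m → Set
PathEdge m i j = ∣ toℕ i - toℕ j ∣ ≡ 1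

IsPathPartition : (G : Graph) (m : ℕ) → (Fin (n G) → Fin m) → Set
IsPathPartition G m f =
  ∀ v w → Edge G v w → (f v ≡ f w) ⊎ PathEdge m (f v) (f w)

fiberSize : (G : Graph) (m : ℕ) → (Fin (n G) → Fin m) → Fin m → ℕ
fiberSize G m f x = length (filter (λ v → f v ≟ x) (allFin (n G)))

partitionWidth : (G : Graph) (m : ℕ) → (Fin (n G) → Fin m) → ℕ
partitionWidth G m f = maxL (map (fiberSize G m f) (allFin m))

IsPathPartitionWidth : Graph → ℕ → Set
IsPathPartitionWidth G k =
  Σ ℕ (λ m → Σ (Fin (n G) → Fin m) λ f →
      IsPathPartition G m f × partitionWidth G m f ≡ k)
  × (∀ (m : ℕ) (f : Fin (n G) → Fin m) →
      IsPathPartition G m f → k ≤ partitionWidth G m f)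

{-# OPTIONS --safe #-}
-- Cutting an ordering of width d ≥ 1 into consecutive blocks of d positions gives a
-- path-partition of width at most d: an edge spans at most d positions, so it joins equal or
-- consecutive blocks.  Conversely, list the vertices of a path-partition f of width k block by
-- block, i.e. lexicographically by (f u, u).  For an edge vw with v listed first, f w ≤ f v + 1,
-- so every vertex from v up to (excluding) w lies in f⁻¹(f v) or in f⁻¹(f w) ∖ {w}; hence w is
-- fewer than 2k places after v, and the listing has width at most 2k − 1.
module Submission where

open import Defs
open import Data.Nat using (ℕ; _+_; _*_; _≤_)
open import Data.Product using (_×_)

open import Level using (Level; 0ℓ)
open import Function using (_∘_; id)
open import Function.Bundles using (Injection)
open import Function.Definitions using (Injective; StrictlySurjective)
open import Function.Properties.Inverse using (Inverse⇒Injection)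
open import Data.Empty using (⊥-elim)
open import Data.Bool using (true; false; if_then_else_)
open import Data.Sum using (_⊎_; inj₁; inj₂; [_,_]′)
open import Data.Product using (∃; ∃₂; _,_; proj₁; proj₂)
open import Data.Nat using (zero; suc; pred; _<_; _∸_; ∣_-_∣; z≤n; s≤s; NonZero; >-nonZero)
open import Data.Nat.Properties hiding (_≟_)
open import Data.Nat.DivMod using (_/_; _%_; m/n≤m; m/n*n≤m; /-monoˡ-≤; m/n≡1+[m∸n]/n; m≡m%n+[m/n]*n; m%n<n)
open import Data.Fin as Fin using (Fin; toℕ; fromℕ<; combine; punchOut; _≟_)
open import Data.Fin.Properties using (toℕ-injective; toℕ-fromℕ<; toℕ<n; any?; punchOut-injective; injective⇒≤; combine-monoˡ-<; combine-injectiveʳ)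
open import Data.Fin.Permutation using (Permutation′; permutation; _⟨$⟩ʳ_)
open import Data.List using (List; length; filter; map; concatMap; tabulate; allFin)
open import Data.List.Properties using (foldr-preservesᵇ; foldr-forcesᵇ)
open import Data.List.Relation.Unary.All using (All)
open import Data.List.Relation.Unary.All.Properties using (concat⁺; concat⁻; map⁺; map⁻; tabulate⁺; tabulate⁻)
open import Algebra.Properties.CommutativeMonoid.Sum +-0-commutativeMonoid using (sum; sum-permute; ∑-distrib-+)
open import Relation.Unary using (Pred; Decidable; _⊆_; _∪_)
open import Relation.Unary.Properties using (U?)
open import Relation.Nullary using (Dec; yes; no; ¬_; contradiction)
open import Relation.Nullary.Decidable using (_×-dec_)
open import Relation.Binary using (tri<; tri≈; tri>)
open import Relation.Binary.PropositionalEquality as ≡ using (_≡_; _≢_; refl; trans; cong; subst; subst₂)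

private
  variable
    a p q r : Level
    A B C : Set a
    N : ℕ
    P : Pred (Fin N) p
    Q : Pred (Fin N) q
    R : Pred (Fin N) r

indicator : Dec A → ℕ
indicator (yes _) = 1
indicator (no _)  = 0

indicator-mono : (A → B) → (a? : Dec A) (b? : Dec B) → indicator a? ≤ indicator b?
indicator-mono _   (no _)  _        = z≤n
indicator-mono _   (yes _) (yes _)  = ≤-refl
indicator-mono A→B (yes x) (no ¬y)  = contradiction (A→B x) ¬y

indicator-⊎ : (A → B ⊎ C) → (a? : Dec A) (b? : Dec B) (c? : Dec C) →
              indicator a? ≤ indicator b? + indicator c?
indicator-⊎ _     (no _)  _       _       = z≤n
indicator-⊎ _     (yes _) (yes _) _       = s≤s z≤n
indicator-⊎ _     (yes _) (no _)  (yes _) = s≤s z≤n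
indicator-⊎ A→B⊎C (yes x) (no ¬y) (no ¬z) = ⊥-elim ([ ¬y , ¬z ]′ (A→B⊎C x))

indicator-< : ¬ A → B → (a? : Dec A) (b? : Dec B) → indicator a? < indicator b?
indicator-< ¬x _ (yes x) _       = contradiction x ¬x
indicator-< _  y (no _)  (no ¬y) = contradiction y ¬y
indicator-< _  _ (no _)  (yes _) = s≤s z≤n

sum-mono-≤ : {f g : Fin N → ℕ} → (∀ i → f i ≤ g i) → sum f ≤ sum g
sum-mono-≤ {zero}  _   = z≤n
sum-mono-≤ {suc N} f≤g = +-mono-≤ (f≤g Fin.zero) (sum-mono-≤ (f≤g ∘ Fin.suc))

count : Decidable P → ℕ
count P? = sum (indicator ∘ P?)

count-mono : P ⊆ Q → (P? : Decidable P) (Q? : Decidable Q) → count P? ≤ count Q?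
count-mono P⊆Q P? Q? = sum-mono-≤ (λ i → indicator-mono P⊆Q (P? i) (Q? i))

count-⊆∪ : P ⊆ Q ∪ R →
           (P? : Decidable P) (Q? : Decidable Q) (R? : Decidable R) →
           count P? ≤ count Q? + count R?
count-⊆∪ P⊆Q∪R P? Q? R? = ≤-trans
  (sum-mono-≤ (λ i → indicator-⊎ P⊆Q∪R (P? i) (Q? i) (R? i)))
  (≤-reflexive (∑-distrib-+ (indicator ∘ Q?) (indicator ∘ R?)))

count-< : P ⊆ Q → (P? : Decidable P) (Q? : Decidable Q) {w : Fin N} →
          Q w → ¬ P w → count P? < count Q?
count-< P⊆Q P? Q? {Fin.zero} Qw ¬Pw = +-mono-<-≤
  (indicator-< ¬Pw Qw (P? Fin.zero) (Q? Fin.zero))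
  (sum-mono-≤ (λ i → indicator-mono P⊆Q (P? (Fin.suc i)) (Q? (Fin.suc i))))
count-< P⊆Q P? Q? {Fin.suc w} Qw ¬Pw = +-mono-≤-<
  (indicator-mono P⊆Q (P? Fin.zero) (Q? Fin.zero))
  (count-< P⊆Q (P? ∘ Fin.suc) (Q? ∘ Fin.suc) Qw ¬Pw)

count-U : count {N} U? ≡ N
count-U {zero}  = refl
count-U {suc N} = cong suc (count-U {N})

count-permute : (σ : Permutation′ N) (P? : Decidable P) →
                count (P? ∘ (σ ⟨$⟩ʳ_)) ≡ count P?
count-permute σ P? = ≡.sym (sum-permute (indicator ∘ P?) σ)

length-filter-tabulate : {P : Pred A p} (P? : Decidable P) (g : Fin N → A) →
                         length (filter P? (tabulate g)) ≡ count (P? ∘ g)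
length-filter-tabulate {N = zero}  P? g = refl
length-filter-tabulate {N = suc N} P? g with P? (g Fin.zero)
... | yes _ = cong suc (length-filter-tabulate P? (g ∘ Fin.suc))
... | no _  = length-filter-tabulate P? (g ∘ Fin.suc)

Between : ℕ → ℕ → Pred ℕ 0ℓ
Between lo hi j = lo ≤ j × j < hi

between? : ∀ lo hi → Decidable (Between lo hi)
between? lo hi j = (lo ≤? j) ×-dec (j <? hi)

count-between : ∀ lo hi → count (between? lo hi ∘ toℕ {N}) ≤ hi ∸ lo
count-between {zero}  lo hi = z≤n
count-between {suc N} lo hi = begin
  at-0 + count (between? lo hi ∘ suc ∘ toℕ {N})
    ≤⟨ +-monoʳ-≤ at-0 (count-mono shift _ shifted?) ⟩
  at-0 + count (between? (pred lo) (pred hi) ∘ toℕ {N})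
    ≤⟨ +-monoʳ-≤ at-0 (count-between {N} (pred lo) (pred hi)) ⟩
  at-0 + (pred hi ∸ pred lo)
    ≤⟨ zeroth lo hi ⟩
  hi ∸ lo ∎
  where
  open ≤-Reasoning
  at-0 : ℕ
  at-0 = indicator (between? lo hi 0)
  shifted? : Decidable (Between (pred lo) (pred hi) ∘ toℕ {N})
  shifted? = between? (pred lo) (pred hi) ∘ toℕ
  shift : ∀ {j} → Between lo hi (suc j) → Between (pred lo) (pred hi) j
  shift (lo≤1+j , 1+j<hi) = pred-mono-≤ lo≤1+j , pred-mono-≤ 1+j<hi
  zeroth : ∀ lo hi → indicator (between? lo hi 0) + (pred hi ∸ pred lo) ≤ hi ∸ lo
  zeroth zero     zero     = z≤n
  zeroth zero     (suc hi) = ≤-refl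
  zeroth (suc lo) zero     = ≤-reflexive (0∸n≡0 lo)
  zeroth (suc lo) (suc hi) = ≤-refl

injective⇒strictlySurjective : {g : Fin N → Fin N} →
                               Injective _≡_ _≡_ g → StrictlySurjective _≡_ g
injective⇒strictlySurjective {suc N} {g} g-injective i with any? (λ v → g v ≟ i)
... | yes hit = hit
... | no miss = contradiction (injective⇒≤ punchOut∘g-injective) (<-irrefl refl)
  where
  punchOut∘g : Fin (suc N) → Fin N
  punchOut∘g v = punchOut (λ i≡gv → miss (v , ≡.sym i≡gv))
  punchOut∘g-injective : Injective _≡_ _≡_ punchOut∘g
  punchOut∘g-injective eq = g-injective (punchOut-injective {i = i} _ _ eq)

injective⇒permutation : (g : Fin N → Fin N) → Injective _≡_ _≡_ g → Permutation′ N
injective⇒permutation g g-injective =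
  permutation g (proj₁ ∘ surjective) (proj₂ ∘ surjective)
    (λ v → g-injective (proj₂ (surjective (g v))))
  where
  surjective : StrictlySurjective _≡_ g
  surjective = injective⇒strictlySurjective g-injective

module Ranking (key : Fin N → ℕ) (key-injective : Injective _≡_ _≡_ key) where

  rank : Fin N → ℕ
  rank v = count (λ u → key u <? key v)

  rank<N : ∀ v → rank v < N
  rank<N v = subst (rank v <_) count-U
    (count-< _ (λ u → key u <? key v) U? {v} _ (<-irrefl refl))

  rank-mono-< : ∀ {u v} → key u < key v → rank u < rank v
  rank-mono-< {u} {v} ku<kv = count-< (λ x<u → <-trans x<u ku<kv)
    (λ x → key x <? key u) (λ x → key x <? key v) ku<kv (<-irrefl refl)

  rank-injective : Injective _≡_ _≡_ rank
  rank-injective {u} {v} ru≡rv with <-cmp (key u) (key v)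
  ... | tri< ku<kv _ _ = contradiction ru≡rv (<⇒≢ (rank-mono-< ku<kv))
  ... | tri≈ _ ku≡kv _ = key-injective ku≡kv
  ... | tri> _ _ kv<ku = contradiction (≡.sym ru≡rv) (<⇒≢ (rank-mono-< kv<ku))

  ranking : Permutation′ N
  ranking = injective⇒permutation (λ v → fromℕ< (rank<N v)) λ {u} {v} eq →
    rank-injective (subst₂ _≡_ (toℕ-fromℕ< (rank<N u)) (toℕ-fromℕ< (rank<N v)) (cong toℕ eq))

  toℕ-ranking : ∀ v → toℕ (ranking ⟨$⟩ʳ v) ≡ rank v
  toℕ-ranking v = toℕ-fromℕ< (rank<N v)

  ∣rank-rank∣≤count-between : ∀ {v w} → key v < key w →
    ∣ rank v - rank w ∣ ≤ count (between? (key v) (key w) ∘ key)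
  ∣rank-rank∣≤count-between {v} {w} kv<kw = begin
    ∣ rank v - rank w ∣ ≡⟨ m≤n⇒∣m-n∣≡n∸m (<⇒≤ (rank-mono-< kv<kw)) ⟩
    rank w ∸ rank v     ≤⟨ m≤n+o⇒m∸n≤o (rank w) (rank v) rank-w≤ ⟩
    count (between? (key v) (key w) ∘ key) ∎
    where
    open ≤-Reasoning
    split : ∀ {u} → key u < key w → key u < key v ⊎ Between (key v) (key w) (key u)
    split {u} ku<kw with key u <? key v
    ... | yes ku<kv = inj₁ ku<kv
    ... | no  ku≮kv = inj₂ (≮⇒≥ ku≮kv , ku<kw)
    rank-w≤ : rank w ≤ rank v + count (between? (key v) (key w) ∘ key)
    rank-w≤ = count-⊆∪ split
      (λ u → key u <? key w) (λ u → key u <? key v) (between? (key v) (key w) ∘ key)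

All≤maxL : (xs : List ℕ) → All (_≤ maxL xs) xs
All≤maxL xs = foldr-forcesᵇ (λ x y x⊔y≤ → m⊔n≤o⇒m≤o x y x⊔y≤ , m⊔n≤o⇒n≤o x y x⊔y≤) 0 xs ≤-refl

module _ {P : Pred ℕ p} (g : Fin N → Fin N → ℕ) where

  All-entries⁺ : (∀ v w → P (g v w)) →
                 All P (concatMap (λ v → map (g v) (allFin N)) (allFin N))
  All-entries⁺ Pg = concat⁺ (map⁺ (tabulate⁺ (λ v → map⁺ (tabulate⁺ (Pg v)))))

  All-entries⁻ : All P (concatMap (λ v → map (g v) (allFin N)) (allFin N)) →
                 ∀ v w → P (g v w)
  All-entries⁻ Pentries v = tabulate⁻ (map⁻ (tabulate⁻ (map⁻ (concat⁻ Pentries)) v))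

edge-sym : ∀ G {v w} → Edge G v w → Edge G w v
edge-sym G {v} {w} vw = trans (Graph.sym G w v) vw

edge⇒≢ : ∀ G {v w} → Edge G v w → v ≢ w
edge⇒≢ G {v} vw refl with trans (≡.sym vw) (irrefl G v)
... | ()

module _ (G : Graph) (σ : Permutation′ (n G)) where

  position : Fin (n G) → ℕ
  position v = toℕ (σ ⟨$⟩ʳ v)

  private
    stretch : Fin (n G) → Fin (n G) → ℕ
    stretch v w = if adj G v w then ∣ position v - position w ∣ else 0

  ∣position-position∣≤orderingWidth : ∀ {v w} → Edge G v w →
                                      ∣ position v - position w ∣ ≤ orderingWidth G σ
  ∣position-position∣≤orderingWidth {v} {w} vw =
    subst (λ b → (if b then ∣ position v - position w ∣ else 0) ≤ orderingWidth G σ) vw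
      (All-entries⁻ stretch (All≤maxL _) v w)

  orderingWidth-< : ∀ {B} → HasEdge G →
                    (∀ {v w} → Edge G v w → ∣ position v - position w ∣ < B) →
                    orderingWidth G σ < B
  orderingWidth-< {B} (v₀ , w₀ , v₀w₀) stretch<B =
    foldr-preservesᵇ {P = _< B} ⊔-pres-<m (m<n⇒0<n (stretch<B v₀w₀)) (All-entries⁺ stretch entry<B)
    where
    entry<B : ∀ v w → stretch v w < B
    entry<B v w with adj G v w in vw
    ... | true  = stretch<B vw
    ... | false = m<n⇒0<n (stretch<B v₀w₀)

  orderingWidth-nonZero : HasEdge G → NonZero (orderingWidth G σ)
  orderingWidth-nonZero (v , w , vw) =
    >-nonZero (<-≤-trans (n≢0⇒n>0 positions-differ) (∣position-position∣≤orderingWidth vw))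
    where
    positions-differ : ∣ position v - position w ∣ ≢ 0
    positions-differ eq = edge⇒≢ G vw
      (Injection.injective (Inverse⇒Injection σ) (toℕ-injective (∣m-n∣≡0⇒m≡n eq)))

module _ (G : Graph) {m : ℕ} (f : Fin (n G) → Fin m) where

  fiberSize≡count : ∀ x → fiberSize G m f x ≡ count (λ u → f u ≟ x)
  fiberSize≡count x = length-filter-tabulate (λ u → f u ≟ x) id

  fiberSize≤partitionWidth : ∀ x → fiberSize G m f x ≤ partitionWidth G m f
  fiberSize≤partitionWidth = tabulate⁻ (map⁻ (All≤maxL _))

  partitionWidth-lub : ∀ {B} → (∀ x → fiberSize G m f x ≤ B) → partitionWidth G m f ≤ B
  partitionWidth-lub {B} fiber≤B =
    foldr-preservesᵇ {P = _≤ B} ⊔-lub z≤n (map⁺ (tabulate⁺ fiber≤B))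

∣-∣≤1⇒≡⊎PathEdge : ∀ {m} {i j : Fin m} → ∣ toℕ i - toℕ j ∣ ≤ 1 → i ≡ j ⊎ PathEdge m i j
∣-∣≤1⇒≡⊎PathEdge {i = i} {j} ∣i-j∣≤1 with ∣ toℕ i - toℕ j ∣ in eq
... | 0 = inj₁ (toℕ-injective (∣m-n∣≡0⇒m≡n eq))
... | 1 = inj₂ refl
... | suc (suc _) with s≤s () ← ∣i-j∣≤1

≡⊎PathEdge⇒∣-∣≤1 : ∀ {m} {i j : Fin m} → i ≡ j ⊎ PathEdge m i j → ∣ toℕ i - toℕ j ∣ ≤ 1
≡⊎PathEdge⇒∣-∣≤1 {i = i} (inj₁ refl) = ≤-trans (≤-reflexive (∣n-n∣≡0 (toℕ i))) z≤n
≡⊎PathEdge⇒∣-∣≤1 (inj₂ i~j)          = ≤-reflexive i~j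

module _ (d : ℕ) .{{_ : NonZero d}} where

  ∣m-n∣≤d⇒∣m/d-n/d∣≤1 : ∀ x y → ∣ x - y ∣ ≤ d → ∣ x / d - y / d ∣ ≤ 1
  ∣m-n∣≤d⇒∣m/d-n/d∣≤1 x y ∣x-y∣≤d = [ (λ x≤y → ordered x≤y ∣x-y∣≤d) , swapped ]′ (≤-total x y)
    where
    open ≤-Reasoning
    ordered : ∀ {x y} → x ≤ y → ∣ x - y ∣ ≤ d → ∣ x / d - y / d ∣ ≤ 1
    ordered {x} {y} x≤y ∣x-y∣≤d = begin
      ∣ x / d - y / d ∣ ≡⟨ m≤n⇒∣m-n∣≡n∸m (/-monoˡ-≤ d x≤y) ⟩
      y / d ∸ x / d     ≤⟨ m≤n+o⇒m∸n≤o (y / d) (x / d) y/d≤x/d+1 ⟩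
      1                 ∎
      where
      y≤d+x : y ≤ d + x
      y≤d+x = ≤-trans (m≤∣m-n∣+n y x) (+-monoˡ-≤ x (subst (_≤ d) (∣-∣-comm x y) ∣x-y∣≤d))
      y/d≤x/d+1 : y / d ≤ x / d + 1
      y/d≤x/d+1 = begin
        y / d               ≤⟨ /-monoˡ-≤ d y≤d+x ⟩
        (d + x) / d         ≡⟨ m/n≡1+[m∸n]/n (m≤m+n d x) ⟩
        1 + (d + x ∸ d) / d ≡⟨ cong (λ z → 1 + z / d) (m+n∸m≡n d x) ⟩
        1 + x / d           ≡⟨ +-comm 1 (x / d) ⟩
        x / d + 1           ∎
    swapped : y ≤ x → ∣ x / d - y / d ∣ ≤ 1
    swapped y≤x = subst (_≤ 1) (∣-∣-comm (y / d) (x / d))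
      (ordered y≤x (subst (_≤ d) (∣-∣-comm x y) ∣x-y∣≤d))

  /≡⇒Between : ∀ {x X} → x / d ≡ X → Between (X * d) (X * d + d) x
  /≡⇒Between {x} {X} refl = m/n*n≤m x d , (begin-strict
    x                 ≡⟨ m≡m%n+[m/n]*n x d ⟩
    x % d + X * d     <⟨ +-monoˡ-< (X * d) (m%n<n x d) ⟩
    d + X * d         ≡⟨ +-comm d (X * d) ⟩
    X * d + d         ∎)
    where open ≤-Reasoning

  module Blocks (G : Graph) (σ : Permutation′ (n G)) where

    block : Fin (n G) → Fin (n G)
    block v = fromℕ< (≤-<-trans (m/n≤m (position G σ v) d) (toℕ<n (σ ⟨$⟩ʳ v)))

    toℕ-block : ∀ v → toℕ (block v) ≡ position G σ v / d
    toℕ-block v = toℕ-fromℕ< _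

    block-isPathPartition : orderingWidth G σ ≤ d → IsPathPartition G (n G) block
    block-isPathPartition width≤d v w vw = ∣-∣≤1⇒≡⊎PathEdge
      (subst₂ (λ i j → ∣ i - j ∣ ≤ 1) (≡.sym (toℕ-block v)) (≡.sym (toℕ-block w))
        (∣m-n∣≤d⇒∣m/d-n/d∣≤1 _ _ (≤-trans (∣position-position∣≤orderingWidth G σ vw) width≤d)))

    fiberSize-block≤d : ∀ x → fiberSize G (n G) block x ≤ d
    fiberSize-block≤d x = begin
      fiberSize G (n G) block x              ≡⟨ fiberSize≡count G block x ⟩
      count (λ v → block v ≟ x)              ≤⟨ count-mono in-block (λ v → block v ≟ x) _ ⟩
      count (between? lo hi ∘ position G σ)  ≡⟨ count-permute σ (between? lo hi ∘ toℕ) ⟩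
      count (between? lo hi ∘ toℕ {n G})     ≤⟨ count-between {n G} lo hi ⟩
      hi ∸ lo                                ≡⟨ m+n∸m≡n lo d ⟩
      d                                      ∎
      where
      open ≤-Reasoning
      lo hi : ℕ
      lo = toℕ x * d
      hi = lo + d
      in-block : ∀ {v} → block v ≡ x → Between lo hi (position G σ v)
      in-block {v} refl = /≡⇒Between (≡.sym (toℕ-block v))

pathPartition-of-ordering : (G : Graph) → HasEdge G → (σ : Permutation′ (n G)) →
  ∃₂ λ m (f : Fin (n G) → Fin m) →
    IsPathPartition G m f × partitionWidth G m f ≤ orderingWidth G σ
pathPartition-of-ordering G edge σ =
  n G , block , block-isPathPartition ≤-refl , partitionWidth-lub G block fiberSize-block≤d
  where
  instance
    width-nonZero : NonZero (orderingWidth G σ)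
    width-nonZero = orderingWidth-nonZero G σ edge
  open Blocks (orderingWidth G σ) G σ

module ListingByBlocks (G : Graph) {m : ℕ} (f : Fin (n G) → Fin m)
                       (f-isPathPartition : IsPathPartition G m f) where

  key : Fin (n G) → ℕ
  key u = toℕ (combine (f u) u)

  key-injective : Injective _≡_ _≡_ key
  key-injective {u} {v} eq = combine-injectiveʳ (f u) u (f v) v (toℕ-injective eq)

  key-≤⇒f-≤ : ∀ {u v} → key u ≤ key v → toℕ (f u) ≤ toℕ (f v)
  key-≤⇒f-≤ {u} {v} ku≤kv = ≮⇒≥ (λ fv<fu → <⇒≱ (combine-monoˡ-< v u fv<fu) ku≤kv)

  open Ranking key key-injective public

  width : ℕ
  width = partitionWidth G m f

  fiber? : (x : Fin m) → Decidable (λ u → f u ≡ x)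
  fiber? x u = f u ≟ x

  count-fiber≤width : ∀ x → count (fiber? x) ≤ width
  count-fiber≤width x = subst (_≤ width) (fiberSize≡count G f x) (fiberSize≤partitionWidth G f x)

  module _ {v w} (vw : Edge G v w) (kv<kw : key v < key w) where

    between-keys⊆fibers : ∀ {u} → Between (key v) (key w) (key u) →
                          f u ≡ f v ⊎ (f u ≡ f w × key u < key w)
    between-keys⊆fibers {u} (kv≤ku , ku<kw) with f u ≟ f w
    ... | yes fu≡fw = inj₂ (fu≡fw , ku<kw)
    ... | no  fu≢fw = inj₁ (toℕ-injective (≤-antisym fu≤fv (key-≤⇒f-≤ kv≤ku)))
      where
      fw≤1+fv : toℕ (f w) ≤ suc (toℕ (f v))
      fw≤1+fv = ≤-trans (m≤∣m-n∣+n (toℕ (f w)) (toℕ (f v)))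
        (+-monoˡ-≤ (toℕ (f v)) (≡⊎PathEdge⇒∣-∣≤1 (f-isPathPartition w v (edge-sym G vw))))
      fu≤fv : toℕ (f u) ≤ toℕ (f v)
      fu≤fv = m<1+n⇒m≤n (<-≤-trans fu<fw fw≤1+fv)
        where
        fu<fw : toℕ (f u) < toℕ (f w)
        fu<fw = ≤∧≢⇒< (key-≤⇒f-≤ (<⇒≤ ku<kw)) (fu≢fw ∘ toℕ-injective)

    count-between-keys<2width : count (between? (key v) (key w) ∘ key) < width + width
    count-between-keys<2width = begin-strict
      count (between? (key v) (key w) ∘ key)
        ≤⟨ count-⊆∪ between-keys⊆fibers _ (fiber? (f v)) before-w? ⟩
      count (fiber? (f v)) + count before-w?
        <⟨ +-mono-≤-< (count-fiber≤width (f v)) before-w<width ⟩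
      width + width ∎
      where
      open ≤-Reasoning
      before-w? : Decidable (λ u → f u ≡ f w × key u < key w)
      before-w? u = fiber? (f w) u ×-dec (key u <? key w)
      before-w<width : count before-w? < width
      before-w<width = <-≤-trans
        (count-< proj₁ before-w? (fiber? (f w)) {w} refl (<-irrefl refl ∘ proj₂))
        (count-fiber≤width (f w))

  ∣rank-rank∣<2width : ∀ {v w} → Edge G v w → ∣ rank v - rank w ∣ < width + width
  ∣rank-rank∣<2width {v} {w} vw with <-cmp (key v) (key w)
  ... | tri< kv<kw _ _ =
    ≤-<-trans (∣rank-rank∣≤count-between kv<kw) (count-between-keys<2width vw kv<kw)
  ... | tri≈ _ kv≡kw _ = contradiction (key-injective kv≡kw) (edge⇒≢ G vw)
  ... | tri> _ _ kw<kv = subst (_< width + width) (∣-∣-comm (rank w) (rank v))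
    (≤-<-trans (∣rank-rank∣≤count-between kw<kv) (count-between-keys<2width (edge-sym G vw) kw<kv))

  orderingWidth-ranking<2width : HasEdge G → orderingWidth G ranking < 2 * width
  orderingWidth-ranking<2width edge =
    subst (orderingWidth G ranking <_) (cong (width +_) (≡.sym (+-identityʳ width)))
      (orderingWidth-< G ranking edge (λ {v} {w} vw →
        subst₂ (λ i j → ∣ i - j ∣ < width + width) (≡.sym (toℕ-ranking v)) (≡.sym (toℕ-ranking w))
          (∣rank-rank∣<2width vw)))

ordering-of-pathPartition : (G : Graph) → HasEdge G →
  {m : ℕ} (f : Fin (n G) → Fin m) → IsPathPartition G m f →
  ∃ λ σ → orderingWidth G σ < 2 * partitionWidth G m f
ordering-of-pathPartition G edge f f-isPathPartition = ranking , orderingWidth-ranking<2width edge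
  where open ListingByBlocks G f f-isPathPartition

lemma1 : (G : Graph) → HasEdge G → (b k : ℕ) →
    IsBandwidth G b → IsPathPartitionWidth G k →
    (b + 1 ≤ 2 * k) × (k ≤ b)
lemma1 G edge b k ((σ , width-σ≡b) , b-minimal)
                  ((m , f , f-isPathPartition , width-f≡k) , k-minimal) = bw+1≤2ppw , ppw≤bw
  where
  bw+1≤2ppw : b + 1 ≤ 2 * k
  bw+1≤2ppw with τ , width-τ<2k ← ordering-of-pathPartition G edge f f-isPathPartition =
    subst₂ (λ i j → i ≤ 2 * j) (+-comm 1 b) width-f≡k (<-≤-trans (s≤s (b-minimal τ)) width-τ<2k)
  ppw≤bw : k ≤ b
  ppw≤bw with m′ , f′ , f′-isPathPartition , width-f′≤ ← pathPartition-of-ordering G edge σ =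
    subst (k ≤_) width-σ≡b (≤-trans (k-minimal m′ f′ f′-isPathPartition) width-f′≤)
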